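{- If $n$ is a perfect number (i.e. $\sigma(n)=2n$), then $H_2(n)=\frac{n\,d^*(n)}{\sigma(n)}$ and $H_4(n)=\frac{n\,d^{**}(n)}{\sigma(n)}$ are integers. If $n>1$ and $H_2(n)$ is an integer, then $n$ is not a perfect square.
   Context: $\sigma(n)$ is the sum of the positive divisors of $n$. A divisor $d$ of $n$ is unitary if $\gcd(d,n/d)=1$; $d^*(n)$ is the number of unitary divisors of $n$. A divisor $d$ of $n$ is bi-unitary if the greatest common unitary divisor of $d$ and $n/d$ is $1$; $d^{**}(n)$ is the number of bi-unitary divisors of $n$. -}

module Defs where

open import Data.Nat using (ℕ; zero; suc; _⊔_; _≟_)
open import Data.Nat.Divisibility using (_∣?_)
open import Data.Nat.DivMod using (_/_)
open import Data.Nat.GCD using (gcd)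
open import Data.List using (List; filter; map; upTo; length; foldr)
open import Data.Nat.ListAction using (sum)
open import Data.List.Relation.Unary.Any using (any?)

-- positive divisors of n, i.e. d ∈ {1,…,n} with d ∣ n  (empty for n = 0)
divisors : ℕ → List ℕ
divisors n = filter (_∣? n) (map suc (upTo n))

-- cofactor n/d (only used for positive divisors d)
cofactor : ℕ → ℕ → ℕ
cofactor n zero    = zero
cofactor n (suc k) = n / suc k

σ : ℕ → ℕ
σ n = sum (divisors n)

unitaryDivisors : ℕ → List ℕ
unitaryDivisors n = filter (λ d → gcd d (cofactor n d) ≟ 1) (divisors n)

d* : ℕ → ℕ
d* n = length (unitaryDivisors n)

gcud : ℕ → ℕ → ℕ
gcud a b = foldr _⊔_ 0
  (filter (λ k → any? (k ≟_) (unitaryDivisors b)) (unitaryDivisors a))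

biUnitaryDivisors : ℕ → List ℕ
biUnitaryDivisors n = filter (λ d → gcud d (cofactor n d) ≟ 1) (divisors n)

d** : ℕ → ℕ
d** n = length (biUnitaryDivisors n)

-- Both halves rest on the involution d ↦ n/d of the divisors of n.
-- * For n > 1 it has no fixed point among the unitary divisors (a fixed point d
--   would satisfy gcd(d,d) = 1) nor among the bi-unitary ones (gcud(d,d) = d),
--   so d*(n) and d**(n) are even; hence σ(n) = 2n divides n·d*(n) and n·d**(n).
-- * For n = m², σ(n) is odd: its parity is that of the number of odd divisors,
--   and d ↦ m²/d on the odd divisors of m² (m odd; even m reduce to m/2) fixes
--   exactly m.  Also d*(n) is a power of 2, because d ↦ n/d exchanges the
--   unitary divisors of n = pᵃr (p ∤ r) divisible by p with those that are not,
--   and the latter are the unitary divisors of r.  So σ(n) ∣ n·d*(n) forces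
--   σ(n) ∣ n, contradicting σ(n) > n.
module Submission where

open import Defs
open import Data.Nat using (ℕ; zero; suc; _+_; _*_; _^_; _/_; _≤_; _<_; _⊔_; _≟_; z≤n; s≤s; >-nonZero; nonTrivial⇒n>1)
open import Data.Nat.Properties
open import Data.Nat.Divisibility
open import Data.Nat.GCD using (gcd; gcd-comm)
open import Data.Nat.Coprimality using (Coprime; coprime-divisor; coprime⇒gcd≡1; gcd≡1⇒coprime)
open import Data.Nat.Primality using (Prime; prime⇒irreducible; prime⇒nonTrivial; prime[2]; euclidsLemma)
open import Data.Nat.Primality.Factorisation using (factorise)
open import Data.Nat.Induction using (<-rec)
open import Data.Nat.Tactic.RingSolver using (solve-∀)
open import Data.Nat.ListAction using (sum; product)
open import Data.Nat.ListAction.Properties using (sum-↭)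
open import Data.Nat.DivMod using (m*n/n≡m; m*[n/m]≡n)
open import Data.List using (List; []; _∷_; filter; map; upTo; length; foldr)
open import Data.List.Properties using (filter-accept; filter-reject; filter-all)
open import Data.List.Membership.Propositional using (_∈_)
open import Data.List.Membership.Propositional.Properties using (∈-filter⁺; ∈-filter⁻; ∈-map⁺; ∈-map⁻; ∈-upTo⁺; ∈-upTo⁻)
open import Data.List.Relation.Unary.Any using (here; there; any?)
import Data.List.Relation.Unary.All as All
open import Data.List.Relation.Unary.AllPairs using (_∷_)
open import Data.List.Relation.Unary.Unique.Propositional using (Unique)
open import Data.List.Relation.Unary.Unique.Propositional.Properties using (filter⁺; map⁺; upTo⁺)
open import Data.List.Relation.Binary.Permutation.Propositional using (_↭_; prep; swap; ↭-refl; ↭-trans)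
open import Data.List.Relation.Binary.Permutation.Propositional.Properties using (↭-length)
open import Data.Product using (_×_; _,_; proj₁; proj₂; ∃-syntax)
open import Data.Sum using (inj₁; inj₂)
open import Function using (_∘_; case_of_)
open import Level using (0ℓ)
open import Relation.Nullary using (¬_; yes; no; ¬?)
open import Relation.Nullary.Negation using (contradiction)
open import Relation.Unary using (Pred; Decidable)
open import Relation.Binary.PropositionalEquality
open import Relation.Binary.Definitions using (tri<; tri≈; tri>)

variable
  a b c d e k m n p r s x y z : ℕ
  xs ys : List ℕ
  f : ℕ → ℕ

remove : ℕ → List ℕ → List ℕ
remove a = filter (λ y → ¬? (y ≟ a))

∈-remove⁺ : y ∈ xs → y ≢ a → y ∈ remove a xs
∈-remove⁺ {a = a} = ∈-filter⁺ (λ y → ¬? (y ≟ a))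

∈-remove⁻ : y ∈ remove a xs → y ∈ xs × y ≢ a
∈-remove⁻ {a = a} = ∈-filter⁻ (λ y → ¬? (y ≟ a))

remove-unique : Unique xs → Unique (remove a xs)
remove-unique {a = a} = filter⁺ (λ y → ¬? (y ≟ a))

remove-absent : (∀ {y} → y ∈ xs → y ≢ a) → remove a xs ≡ xs
remove-absent {a = a} a∉xs = filter-all (λ y → ¬? (y ≟ a)) (All.tabulate a∉xs)

unique⇒↭-remove : Unique xs → a ∈ xs → xs ↭ a ∷ remove a xs
unique⇒↭-remove {x ∷ xs} {a} (x∉xs ∷ _) (here refl)
  rewrite filter-reject (λ y → ¬? (y ≟ a)) {x = x} {xs = xs} (λ x≢x → x≢x refl)
        | remove-absent {xs = xs} {a = x} (λ y∈ y≡x → All.lookup x∉xs y∈ (sym y≡x))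
  = ↭-refl
unique⇒↭-remove {x ∷ xs} {a} (x∉xs ∷ u) (there a∈xs)
  rewrite filter-accept (λ y → ¬? (y ≟ a)) {x = x} {xs = xs} (All.lookup x∉xs a∈xs)
  = ↭-trans (prep x (unique⇒↭-remove u a∈xs)) (swap x a ↭-refl)

length-remove : Unique xs → a ∈ xs → length xs ≡ suc (length (remove a xs))
length-remove u a∈xs = ↭-length (unique⇒↭-remove u a∈xs)

sum-remove : Unique xs → a ∈ xs → sum xs ≡ a + sum (remove a xs)
sum-remove u a∈xs = sum-↭ (unique⇒↭-remove u a∈xs)

∈⇒≤sum : a ∈ xs → a ≤ sum xs
∈⇒≤sum {xs = x ∷ xs} (here refl) = m≤m+n x (sum xs)
∈⇒≤sum {xs = x ∷ xs} (there a∈xs) = ≤-trans (∈⇒≤sum a∈xs) (m≤n+m (sum xs) x)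

sum-pair : Unique xs → a ∈ xs → b ∈ xs → b ≢ a → a + b ≤ sum xs
sum-pair {a = a} u a∈xs b∈xs b≢a = subst (a + _ ≤_) (sym (sum-remove u a∈xs))
  (+-monoʳ-≤ a (∈⇒≤sum (∈-remove⁺ b∈xs b≢a)))

injection⇒length-≤ : (g : ℕ → ℕ) → Unique xs → Unique ys →
  (∀ {x} → x ∈ xs → g x ∈ ys) →
  (∀ {x y} → x ∈ xs → y ∈ xs → g x ≡ g y → x ≡ y) → length xs ≤ length ys
injection⇒length-≤ {[]} g _ _ _ _ = z≤n
injection⇒length-≤ {x ∷ xs} {ys} g (x∉xs ∷ u) uys into inj =
  subst (suc (length xs) ≤_) (sym (length-remove uys (into (here refl))))
    (s≤s (injection⇒length-≤ g u (remove-unique uys) into′ (λ p q → inj (there p) (there q))))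
  where
  into′ : ∀ {y} → y ∈ xs → g y ∈ remove (g x) ys
  into′ y∈xs = ∈-remove⁺ (into (there y∈xs))
    (λ gy≡gx → All.lookup x∉xs y∈xs (sym (inj (there y∈xs) (here refl) gy≡gx)))

inverses⇒length-≡ : (g h : ℕ → ℕ) → Unique xs → Unique ys →
  (∀ {x} → x ∈ xs → g x ∈ ys) → (∀ {y} → y ∈ ys → h y ∈ xs) →
  (∀ {x} → x ∈ xs → h (g x) ≡ x) → (∀ {y} → y ∈ ys → g (h y) ≡ y) →
  length xs ≡ length ys
inverses⇒length-≡ g h uxs uys g-into h-into hg gh = ≤-antisym
  (injection⇒length-≤ g uxs uys g-into (λ p q eq → trans (sym (hg p)) (trans (cong h eq) (hg q))))
  (injection⇒length-≤ h uys uxs h-into (λ p q eq → trans (sym (gh p)) (trans (cong g eq) (gh q))))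

sameMembers⇒length-≡ : Unique xs → Unique ys →
  (∀ {x} → x ∈ xs → x ∈ ys) → (∀ {y} → y ∈ ys → y ∈ xs) → length xs ≡ length ys
sameMembers⇒length-≡ uxs uys xs⊆ys ys⊆xs =
  inverses⇒length-≡ (λ x → x) (λ y → y) uxs uys xs⊆ys ys⊆xs (λ _ → refl) (λ _ → refl)

length-filter-split : {P : Pred ℕ 0ℓ} (P? : Decidable P) (xs : List ℕ) →
  length (filter P? xs) + length (filter (¬? ∘ P?) xs) ≡ length xs
length-filter-split P? [] = refl
length-filter-split P? (x ∷ xs) with P? x
... | yes _ = cong suc (length-filter-split P? xs)
... | no  _ = trans (+-suc _ _) (cong suc (length-filter-split P? xs))

odd? : Decidable (λ x → ¬ 2 ∣ x)
odd? x = ¬? (2 ∣? x)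

odd⇒even-suc : ¬ 2 ∣ x → 2 ∣ suc x
odd⇒even-suc {zero} odd = contradiction (2 ∣0) odd
odd⇒even-suc {suc zero} _ = ∣-refl
odd⇒even-suc {suc (suc x)} odd =
  ∣m∣n⇒∣m+n ∣-refl (odd⇒even-suc (λ 2∣x → odd (∣m∣n⇒∣m+n ∣-refl 2∣x)))

sum+#odd-even : (xs : List ℕ) → 2 ∣ sum xs + length (filter odd? xs)
sum+#odd-even [] = 2 ∣0
sum+#odd-even (x ∷ xs) with 2 ∣? x
... | yes 2∣x rewrite filter-reject odd? {x = x} {xs = xs} (λ odd → odd 2∣x) =
  subst (2 ∣_) (sym (+-assoc x (sum xs) _)) (∣m∣n⇒∣m+n 2∣x (sum+#odd-even xs))
... | no odd rewrite filter-accept odd? {x = x} {xs = xs} odd =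
  subst (2 ∣_) regroup (∣m∣n⇒∣m+n (odd⇒even-suc odd) (sum+#odd-even xs))
  where
  regroup : suc x + (sum xs + length (filter odd? xs)) ≡ x + sum xs + suc (length (filter odd? xs))
  regroup = trans (cong suc (sym (+-assoc x (sum xs) _))) (sym (+-suc (x + sum xs) _))

record Involution (f : ℕ → ℕ) (xs : List ℕ) : Set where
  field
    unique     : Unique xs
    closed     : ∀ {x} → x ∈ xs → f x ∈ xs
    involutive : ∀ {x} → x ∈ xs → f (f x) ≡ x

removeOrbit : (ℕ → ℕ) → ℕ → List ℕ → List ℕ
removeOrbit f a xs = remove (f a) (remove a xs)

∈-removeOrbit⁻ : ∀ f → y ∈ removeOrbit f a xs → y ∈ xs × y ≢ a × y ≢ f a
∈-removeOrbit⁻ f y∈ with ∈-remove⁻ y∈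
... | y∈′ , y≢fa with ∈-remove⁻ y∈′
...   | y∈xs , y≢a = y∈xs , y≢a , y≢fa

removeOrbit-involution : Involution f xs → a ∈ xs → Involution f (removeOrbit f a xs)
removeOrbit-involution {f} {xs} {a} inv a∈xs = record
  { unique     = remove-unique {xs = remove a xs} (remove-unique unique)
  ; closed     = closed′
  ; involutive = λ y∈ → involutive (proj₁ (∈-removeOrbit⁻ f y∈))
  }
  where
  open Involution inv
  closed′ : ∀ {y} → y ∈ removeOrbit f a xs → f y ∈ removeOrbit f a xs
  closed′ {y} y∈ with ∈-removeOrbit⁻ f y∈
  ... | y∈xs , y≢a , y≢fa = ∈-remove⁺ (∈-remove⁺ (closed y∈xs) fy≢a) fy≢fa
    where
    fy≢a : f y ≢ a
    fy≢a fy≡a = y≢fa (trans (sym (involutive y∈xs)) (cong f fy≡a))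
    fy≢fa : f y ≢ f a
    fy≢fa fy≡fa = y≢a (trans (sym (involutive y∈xs)) (trans (cong f fy≡fa) (involutive a∈xs)))

length-removeOrbit-pair : Involution f xs → a ∈ xs → f a ≢ a →
  length xs ≡ 2 + length (removeOrbit f a xs)
length-removeOrbit-pair {f} {xs} {a} inv a∈xs fa≢a = trans (length-remove unique a∈xs)
  (cong suc (length-remove {xs = remove a xs} (remove-unique unique) (∈-remove⁺ (closed a∈xs) fa≢a)))
  where open Involution inv

length-removeOrbit-fixed : Involution f xs → a ∈ xs → f a ≡ a →
  length xs ≡ 1 + length (removeOrbit f a xs)
length-removeOrbit-fixed {f} {xs} {a} inv a∈xs fa≡a = trans (length-remove unique a∈xs)
  (cong (suc ∘ length) (sym (remove-absent {xs = remove a xs} (λ y∈ y≡fa → proj₂ (∈-remove⁻ {xs = xs} y∈) (trans y≡fa fa≡a)))))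
  where open Involution inv

-- An involution without fixed points pairs up the elements: the length is even.
-- (The recursion removes the orbit of the head, so it runs on the length m.)
fixpointFree⇒even : Involution f xs → (∀ {x} → x ∈ xs → f x ≢ x) → 2 ∣ length xs
fixpointFree⇒even {f} inv noFix = count _ _ inv noFix refl
  where
  count : ∀ m xs → Involution f xs → (∀ {x} → x ∈ xs → f x ≢ x) → length xs ≡ m → 2 ∣ m
  count zero _ _ _ _ = 2 ∣0
  count (suc m) [] _ _ ()
  count (suc m) (x ∷ xs) inv noFix len with length-removeOrbit-pair inv (here refl) (noFix (here refl))
  count (suc zero) (x ∷ xs) inv noFix len | pair = contradiction (suc-injective (trans (sym len) pair)) λ ()
  count (suc (suc m)) (x ∷ xs) inv noFix len | pair = ∣m∣n⇒∣m+n ∣-refl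
    (count m (removeOrbit f x (x ∷ xs)) (removeOrbit-involution inv (here refl))
      (λ y∈ → noFix (proj₁ (∈-removeOrbit⁻ f y∈)))
      (suc-injective (suc-injective (trans (sym pair) len))))

uniqueFixpoint⇒odd : Involution f xs → s ∈ xs → f s ≡ s →
  (∀ {x} → x ∈ xs → f x ≡ x → x ≡ s) → ¬ 2 ∣ length xs
uniqueFixpoint⇒odd {f} {xs} {s} inv s∈xs fs≡s onlyFix 2∣len =
  contradiction (∣1⇒≡1 2∣1) λ ()
  where
  restEven : 2 ∣ length (removeOrbit f s xs)
  restEven = fixpointFree⇒even (removeOrbit-involution inv s∈xs)
    (λ y∈ fy≡y → case ∈-removeOrbit⁻ f y∈ of λ (y∈xs , y≢s , _) → y≢s (onlyFix y∈xs fy≡y))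
  2∣1 : 2 ∣ 1
  2∣1 = ∣m+n∣m⇒∣n (subst (2 ∣_) (trans (length-removeOrbit-fixed inv s∈xs fs≡s) (+-comm 1 _)) 2∣len) restEven

factor-pos : 0 < n → d * c ≡ n → 0 < d
factor-pos {d = zero}  () refl
factor-pos {d = suc _} _  _ = s≤s z≤n

∈-divisors⁺ : 0 < n → 0 < d → d ∣ n → d ∈ divisors n
∈-divisors⁺ {n} {suc k} n>0 _ d∣n =
  ∈-filter⁺ (_∣? n) (∈-map⁺ suc (∈-upTo⁺ (∣⇒≤ {{>-nonZero n>0}} d∣n))) d∣n

∈-divisors⁻ : d ∈ divisors n → 0 < d × d ≤ n × d ∣ n
∈-divisors⁻ {n = n} d∈ with ∈-filter⁻ (_∣? n) {xs = map suc (upTo n)} d∈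
... | d∈range , d∣n with ∈-map⁻ suc d∈range
...   | k , k∈ , refl = s≤s z≤n , ∈-upTo⁻ k∈ , d∣n

∈-divisors-factor : 0 < n → d * c ≡ n → d ∈ divisors n
∈-divisors-factor {c = c} n>0 dc≡n =
  ∈-divisors⁺ n>0 (factor-pos n>0 dc≡n) (divides c (trans (sym dc≡n) (*-comm _ c)))

divisors-unique : ∀ n → Unique (divisors n)
divisors-unique n = filter⁺ (_∣? n) (map⁺ suc-injective (upTo⁺ n))

cofactor-unique : 0 < d → d * c ≡ n → cofactor n d ≡ c
cofactor-unique {suc k} {c} _ refl = trans (cong (_/ suc k) (*-comm (suc k) c)) (m*n/n≡m c (suc k))

cofactor-spec : d ∈ divisors n → d * cofactor n d ≡ n
cofactor-spec {d} {n} d∈ with ∈-divisors⁻ {n = n} d∈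
cofactor-spec {suc k} d∈ | _ , _ , d∣n = m*[n/m]≡n d∣n

cofactor-∈ : d ∈ divisors n → cofactor n d ∈ divisors n
cofactor-∈ {d} {n} d∈ with ∈-divisors⁻ {n = n} d∈
... | d>0 , d≤n , _ = ∈-divisors-factor (≤-trans d>0 d≤n) (trans (*-comm _ d) (cofactor-spec d∈))

cofactor-involutive : d ∈ divisors n → cofactor n (cofactor n d) ≡ d
cofactor-involutive {d} {n} d∈ = cofactor-unique (proj₁ (∈-divisors⁻ {n = n} (cofactor-∈ d∈)))
  (trans (*-comm _ d) (cofactor-spec d∈))

cofactor-fixed⇒square : d ∈ divisors n → cofactor n d ≡ d → d * d ≡ n
cofactor-fixed⇒square {d} d∈ c≡d = trans (cong (d *_) (sym c≡d)) (cofactor-spec d∈)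

cofactor-involution : {P : Pred ℕ 0ℓ} (P? : Decidable P) →
  (∀ {d} → d ∈ divisors n → P d → P (cofactor n d)) →
  Involution (cofactor n) (filter P? (divisors n))
cofactor-involution {n} P? preserved = record
  { unique     = filter⁺ P? (divisors-unique n)
  ; closed     = λ d∈ → case ∈-filter⁻ P? d∈ of λ (d∈n , Pd) →
                   ∈-filter⁺ P? (cofactor-∈ d∈n) (preserved d∈n Pd)
  ; involutive = λ d∈ → cofactor-involutive (proj₁ (∈-filter⁻ P? d∈))
  }

coprime-∣ʳ : Coprime x y → z ∣ y → Coprime x z
coprime-∣ʳ cop z∣y (i∣x , i∣z) = cop (i∣x , ∣-trans i∣z z∣y)

coprime-*ʳ : Coprime x y → Coprime x z → Coprime x (y * z)
coprime-*ʳ coprime-y coprime-z (i∣x , i∣yz) =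
  coprime-z (i∣x , coprime-divisor (λ (j∣i , j∣y) → coprime-y (∣-trans j∣i i∣x , j∣y)) i∣yz)

coprime-^ʳ : Coprime x p → Coprime x (p ^ k)
coprime-^ʳ {k = zero}  _   (_ , i∣1) = ∣1⇒≡1 i∣1
coprime-^ʳ {k = suc k} cop = coprime-*ʳ cop (coprime-^ʳ {k = k} cop)

prime∤⇒coprime : Prime p → ¬ p ∣ x → Coprime x p
prime∤⇒coprime p-prime p∤x (i∣x , i∣p) with prime⇒irreducible p-prime i∣p
... | inj₁ i≡1    = i≡1
... | inj₂ refl   = contradiction i∣x p∤x

unitary? : ∀ n → Decidable (λ d → gcd d (cofactor n d) ≡ 1)
unitary? n d = gcd d (cofactor n d) ≟ 1

biUnitary? : ∀ n → Decidable (λ d → gcud d (cofactor n d) ≡ 1)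
biUnitary? n d = gcud d (cofactor n d) ≟ 1

∈-unitary⁺ : 0 < n → d * c ≡ n → Coprime d c → d ∈ unitaryDivisors n
∈-unitary⁺ {n} {d} {c} n>0 dc≡n cop =
  ∈-filter⁺ (unitary? n) (∈-divisors-factor {c = c} n>0 dc≡n)
    (trans (cong (gcd d) (cofactor-unique {d = d} {c = c} {n = n} (factor-pos {c = c} n>0 dc≡n) dc≡n))
           (coprime⇒gcd≡1 cop))

∈-unitary⁻ : d ∈ unitaryDivisors n → d ∈ divisors n × Coprime d (cofactor n d)
∈-unitary⁻ {n = n} d∈ with ∈-filter⁻ (unitary? n) {xs = divisors n} d∈
... | d∈n , gcd≡1 = d∈n , gcd≡1⇒coprime gcd≡1

-- Coprimality of d and n/d is symmetric, so d ↦ n/d permutes the unitary divisors.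
unitary-involution : ∀ n → Involution (cofactor n) (unitaryDivisors n)
unitary-involution n = cofactor-involution (unitary? n)
  (λ {d} d∈ gcd≡1 → trans (cong (gcd (cofactor n d)) (cofactor-involutive d∈)) (trans (gcd-comm _ d) gcd≡1))

-- A divisor fixed by d ↦ n/d is a square root of n, so it is not 1 when n > 1.
fixedDivisor≢1 : 1 < n → d ∈ divisors n → cofactor n d ≡ d → d ≢ 1
fixedDivisor≢1 {n} n>1 d∈ fixed refl = <⇒≢ n>1 (cofactor-fixed⇒square {n = n} d∈ fixed)

-- For n > 1 the unitary divisors pair off as {d, n/d}, so d*(n) is even.
d*-even : 1 < n → 2 ∣ d* n
d*-even {n} n>1 = fixpointFree⇒even (unitary-involution n) λ {d} d∈ fixed →
  case ∈-unitary⁻ d∈ of λ (d∈n , cop) →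
    fixedDivisor≢1 n>1 d∈n fixed (cop (∣-refl , subst (d ∣_) (sym fixed) ∣-refl))

∈⇒≤foldr-⊔ : x ∈ xs → x ≤ foldr _⊔_ 0 xs
∈⇒≤foldr-⊔ {xs = y ∷ xs} (here refl)  = m≤m⊔n y _
∈⇒≤foldr-⊔ {xs = y ∷ xs} (there x∈xs) = ≤-trans (∈⇒≤foldr-⊔ x∈xs) (m≤n⊔m y _)


foldr-⊔-lub : (∀ {x} → x ∈ xs → x ≤ m) → foldr _⊔_ 0 xs ≤ m
foldr-⊔-lub {[]}     _   = z≤n
foldr-⊔-lub {y ∷ xs} ub = ⊔-lub (ub (here refl)) (foldr-⊔-lub (ub ∘ there))

commonUnitaryDivisors : ℕ → ℕ → List ℕ
commonUnitaryDivisors a b = filter (λ k → any? (k ≟_) (unitaryDivisors b)) (unitaryDivisors a)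

∈-common⁺ : ∀ a b → k ∈ unitaryDivisors a → k ∈ unitaryDivisors b → k ∈ commonUnitaryDivisors a b
∈-common⁺ a b = ∈-filter⁺ (λ k → any? (k ≟_) (unitaryDivisors b))

∈-common⁻ : ∀ a b → k ∈ commonUnitaryDivisors a b → k ∈ unitaryDivisors a × k ∈ unitaryDivisors b
∈-common⁻ a b = ∈-filter⁻ (λ k → any? (k ≟_) (unitaryDivisors b)) {xs = unitaryDivisors a}

-- gcud is symmetric: both sides maximise the same set.
gcud-comm : ∀ a b → gcud a b ≡ gcud b a
gcud-comm a b = ≤-antisym (swap-≤ a b) (swap-≤ b a)
  where
  swap-≤ : ∀ a b → gcud a b ≤ gcud b a
  swap-≤ a b = foldr-⊔-lub λ k∈ → case ∈-common⁻ a b k∈ of λ (k∈a , k∈b) →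
    ∈⇒≤foldr-⊔ (∈-common⁺ b a k∈b k∈a)

gcud-self : 0 < d → gcud d d ≡ d
gcud-self {d} d>0 = ≤-antisym
  (foldr-⊔-lub λ k∈ → proj₁ (proj₂ (∈-divisors⁻ {n = d} (proj₁ (∈-unitary⁻ {n = d} (proj₁ (∈-common⁻ d d k∈)))))))
  (∈⇒≤foldr-⊔ (∈-common⁺ d d d∈ud d∈ud))
  where
  d∈ud : d ∈ unitaryDivisors d
  d∈ud = ∈-unitary⁺ d>0 (*-identityʳ d) (λ (_ , i∣1) → ∣1⇒≡1 i∣1)

-- A bi-unitary divisor is a divisor with gcud(d, n/d) = 1, and this condition
-- is symmetric, so d ↦ n/d permutes the bi-unitary divisors.
∈-biUnitary⁻ : d ∈ biUnitaryDivisors n → d ∈ divisors n × gcud d (cofactor n d) ≡ 1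
∈-biUnitary⁻ {n = n} = ∈-filter⁻ (biUnitary? n) {xs = divisors n}

biUnitary-involution : ∀ n → Involution (cofactor n) (biUnitaryDivisors n)
biUnitary-involution n = cofactor-involution (biUnitary? n)
  (λ {d} d∈ gcud≡1 → trans (cong (gcud (cofactor n d)) (cofactor-involutive d∈)) (trans (gcud-comm (cofactor n d) d) gcud≡1))

-- Likewise the bi-unitary divisors pair off, so d**(n) is even for n > 1.
d**-even : 1 < n → 2 ∣ d** n
d**-even {n} n>1 = fixpointFree⇒even (biUnitary-involution n) λ {d} d∈ fixed →
  case ∈-biUnitary⁻ d∈ of λ (d∈n , gcud≡1) →
    fixedDivisor≢1 n>1 d∈n fixed
      (trans (sym (gcud-self (proj₁ (∈-divisors⁻ {n = n} d∈n)))) (subst (λ c → gcud d c ≡ 1) fixed gcud≡1))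

-- σ(1) = 1, so a perfect number exceeds 1.
perfect⇒1<n : 0 < n → σ n ≡ 2 * n → 1 < n
perfect⇒1<n {suc zero}    _ ()
perfect⇒1<n {suc (suc _)} _ _ = s≤s (s≤s z≤n)

perfect⇒σ∣n*even : σ n ≡ 2 * n → 2 ∣ k → σ n ∣ n * k
perfect⇒σ∣n*even {n} σ≡2n 2∣k =
  subst (_∣ n * _) (trans (*-comm n 2) (sym σ≡2n)) (*-monoʳ-∣ n 2∣k)

-- 1 and n are distinct divisors of n > 1, so σ(n) > n.
n<σ : 1 < n → n < σ n
n<σ {n} n>1 = sum-pair (divisors-unique n)
  (∈-divisors⁺ n>0 (s≤s z≤n) (1∣ n)) (∈-divisors⁺ n>0 n>0 ∣-refl) (λ n≡1 → <⇒≢ n>1 (sym n≡1))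
  where
  n>0 : 0 < n
  n>0 = <-trans (s≤s z≤n) n>1

oddDivisors : ℕ → List ℕ
oddDivisors n = filter odd? (divisors n)

σ-even⇒#oddDivisors-even : 2 ∣ σ n → 2 ∣ length (oddDivisors n)
σ-even⇒#oddDivisors-even {n} = ∣m+n∣m⇒∣n (sum+#odd-even (divisors n))

∈-oddDivisors-double⁻ : 0 < k → d ∈ oddDivisors (2 * k) → d ∈ oddDivisors k
∈-oddDivisors-double⁻ {k} k>0 d∈ with ∈-filter⁻ odd? {xs = divisors (2 * k)} d∈
... | d∈2k , odd with ∈-divisors⁻ {n = 2 * k} d∈2k
...   | d>0 , _ , d∣2k = ∈-filter⁺ odd?
        (∈-divisors⁺ k>0 d>0 (coprime-divisor (prime∤⇒coprime prime[2] odd) d∣2k)) odd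

∈-oddDivisors-double⁺ : 0 < k → d ∈ oddDivisors k → d ∈ oddDivisors (2 * k)
∈-oddDivisors-double⁺ {k} k>0 d∈ with ∈-filter⁻ odd? {xs = divisors k} d∈
... | d∈k , odd with ∈-divisors⁻ {n = k} d∈k
...   | d>0 , _ , d∣k = ∈-filter⁺ odd?
        (∈-divisors⁺ (≤-trans k>0 (m≤m+n k _)) d>0 (∣-trans d∣k (n∣m*n 2))) odd

length-oddDivisors-double : 0 < k → length (oddDivisors (2 * k)) ≡ length (oddDivisors k)
length-oddDivisors-double {k} k>0 =
  sameMembers⇒length-≡ (filter⁺ odd? (divisors-unique (2 * k))) (filter⁺ odd? (divisors-unique k))
    (∈-oddDivisors-double⁻ k>0) (∈-oddDivisors-double⁺ k>0)

square-injective : d * d ≡ m * m → d ≡ m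
square-injective {d} {m} d²≡m² with <-cmp d m
... | tri< d<m _ _ = contradiction d²≡m² (<⇒≢ (*-mono-< d<m d<m))
... | tri≈ _ d≡m _ = d≡m
... | tri> _ _ d>m = contradiction (sym d²≡m²) (<⇒≢ (*-mono-< d>m d>m))

-- For odd m, d ↦ m²/d is an involution of the odd divisors of m² fixing only m.
oddDivisors-oddSquare : 0 < m → ¬ 2 ∣ m → ¬ 2 ∣ length (oddDivisors (m * m))
oddDivisors-oddSquare {m} m>0 m-odd =
  uniqueFixpoint⇒odd involution m∈ (cofactor-unique m>0 refl) onlyFixpoint
  where
  n>0 : 0 < m * m
  n>0 = *-mono-< m>0 m>0
  n-odd : ¬ 2 ∣ m * m
  n-odd 2∣n with euclidsLemma m m prime[2] 2∣n
  ... | inj₁ 2∣m = m-odd 2∣m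
  ... | inj₂ 2∣m = m-odd 2∣m
  involution : Involution (cofactor (m * m)) (oddDivisors (m * m))
  involution = cofactor-involution odd? λ {d} d∈ _ 2∣c →
    n-odd (∣-trans 2∣c (divides d (sym (cofactor-spec d∈))))
  m∈ : m ∈ oddDivisors (m * m)
  m∈ = ∈-filter⁺ odd? (∈-divisors-factor {c = m} n>0 refl) m-odd
  onlyFixpoint : ∀ {d} → d ∈ oddDivisors (m * m) → cofactor (m * m) d ≡ d → d ≡ m
  onlyFixpoint d∈ fixed = square-injective
    (cofactor-fixed⇒square {n = m * m} (proj₁ (∈-filter⁻ odd? {xs = divisors (m * m)} d∈)) fixed)

-- Every square m² > 0 has an odd number of odd divisors: strip factors 2 from m.
oddDivisors-square : ∀ m → 0 < m → ¬ 2 ∣ length (oddDivisors (m * m))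
oddDivisors-square = <-rec _ step
  where
  square-double : ∀ q → q * 2 * (q * 2) ≡ 2 * (2 * (q * q))
  square-double = solve-∀
  step : ∀ m → (∀ {q} → q < m → 0 < q → ¬ 2 ∣ length (oddDivisors (q * q))) →
         0 < m → ¬ 2 ∣ length (oddDivisors (m * m))
  step m ih m>0 with 2 ∣? m
  ... | no m-odd = oddDivisors-oddSquare m>0 m-odd
  ... | yes (divides q refl) = subst (λ l → ¬ 2 ∣ l) (sym same) (ih q<m q>0)
    where
    q>0 : 0 < q
    q>0 = factor-pos {c = 2} m>0 refl
    q<m : q < q * 2
    q<m = m<m*n q 2 {{>-nonZero q>0}} (s≤s (s≤s z≤n))
    qq>0 : 0 < q * q
    qq>0 = *-mono-< q>0 q>0
    same : length (oddDivisors (q * 2 * (q * 2))) ≡ length (oddDivisors (q * q))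
    same = begin
      length (oddDivisors (q * 2 * (q * 2)))   ≡⟨ cong (length ∘ oddDivisors) (square-double q) ⟩
      length (oddDivisors (2 * (2 * (q * q)))) ≡⟨ length-oddDivisors-double (≤-trans qq>0 (m≤m+n _ _)) ⟩
      length (oddDivisors (2 * (q * q)))       ≡⟨ length-oddDivisors-double qq>0 ⟩
      length (oddDivisors (q * q))             ∎
      where open ≡-Reasoning

σ-square-odd : 0 < m → ¬ 2 ∣ σ (m * m)
σ-square-odd {m} m>0 = oddDivisors-square m m>0 ∘ σ-even⇒#oddDivisors-even {n = m * m}

prime>1 : Prime p → 1 < p
prime>1 {p} p-prime = nonTrivial⇒n>1 p {{prime⇒nonTrivial p-prime}}

-- Every n > 1 has a prime divisor (the first factor of its factorisation).
primeDivisor : 1 < n → ∃[ p ] Prime p × p ∣ n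
primeDivisor {n} n>1 with factorise n {{>-nonZero (<-trans (s≤s z≤n) n>1)}}
... | record { factors = [] ; isFactorisation = n≡1 } = contradiction n≡1 (λ n≡1 → <⇒≢ n>1 (sym n≡1))
... | record { factors = p ∷ ps ; isFactorisation = n≡p*ps ; factorsPrime = p-prime All.∷ _ } =
  p , p-prime , divides (product ps) (trans n≡p*ps (*-comm p _))

primePowerPart : Prime p → ∀ n → 0 < n → ∃[ a ] ∃[ r ] n ≡ p ^ a * r × ¬ p ∣ r
primePowerPart {p} p-prime = <-rec _ step
  where
  shift : ∀ x r → x * r * p ≡ p * x * r
  shift x r = trans (*-comm (x * r) p) (sym (*-assoc p x r))
  step : ∀ n → (∀ {q} → q < n → 0 < q → ∃[ a ] ∃[ r ] q ≡ p ^ a * r × ¬ p ∣ r) →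
         0 < n → ∃[ a ] ∃[ r ] n ≡ p ^ a * r × ¬ p ∣ r
  step n ih n>0 with p ∣? n
  ... | no p∤n = 0 , n , sym (+-identityʳ n) , p∤n
  ... | yes (divides q refl) with ih q<n q>0
    where
    q>0 : 0 < q
    q>0 = factor-pos {c = p} n>0 refl
    q<n : q < q * p
    q<n = m<m*n q p {{>-nonZero q>0}} (prime>1 p-prime)
  ...   | a , r , q≡pᵃr , p∤r = suc a , r , trans (cong (_* p) q≡pᵃr) (shift (p ^ a) r) , p∤r

-- Counting the unitary divisors of N = p^(1+a)·r (p prime, p ∤ r): d ↦ N/d
-- exchanges those divisible by p with those that are not, and the latter are
-- exactly the unitary divisors of r; hence d*(N) = 2·d*(r).
module UnitarySplit {p a r : ℕ} (p-prime : Prime p) (p∤r : ¬ p ∣ r) (r>0 : 0 < r) where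

  A : ℕ
  A = p ^ suc a

  N : ℕ
  N = A * r

  N>0 : 0 < N
  N>0 = *-mono-< (m^n>0 p {{>-nonZero (<-trans (s≤s z≤n) (prime>1 p-prime))}} (suc a)) r>0

  p∣N : p ∣ N
  p∣N = ∣-trans (divides (p ^ a) (*-comm p _)) (m∣m*n r)

  withP withoutP : List ℕ
  withP    = filter (p ∣?_) (unitaryDivisors N)
  withoutP = filter (¬? ∘ (p ∣?_)) (unitaryDivisors N)

  cofactor-gains-p : d ∈ unitaryDivisors N → ¬ p ∣ d → p ∣ cofactor N d
  cofactor-gains-p d∈ p∤d with euclidsLemma _ _ p-prime (subst (p ∣_) (sym (cofactor-spec (proj₁ (∈-unitary⁻ {n = N} d∈)))) p∣N)
  ... | inj₁ p∣d = contradiction p∣d p∤d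
  ... | inj₂ p∣c = p∣c

  cofactor-loses-p : d ∈ unitaryDivisors N → p ∣ d → ¬ p ∣ cofactor N d
  cofactor-loses-p d∈ p∣d p∣c = <⇒≢ (prime>1 p-prime) (sym (proj₂ (∈-unitary⁻ {n = N} d∈) (p∣d , p∣c)))

  swap-into : ∀ {P : Pred ℕ 0ℓ} (P? : Decidable P) {Q : Pred ℕ 0ℓ} (Q? : Decidable Q) →
    (∀ {d} → d ∈ unitaryDivisors N → P d → Q (cofactor N d)) →
    d ∈ filter P? (unitaryDivisors N) → cofactor N d ∈ filter Q? (unitaryDivisors N)
  swap-into P? Q? P⇒Q d∈ with ∈-filter⁻ P? {xs = unitaryDivisors N} d∈
  ... | d∈ud , Pd = ∈-filter⁺ Q? (Involution.closed (unitary-involution N) d∈ud) (P⇒Q d∈ud Pd)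

  length-withP≡withoutP : length withP ≡ length withoutP
  length-withP≡withoutP = inverses⇒length-≡ (cofactor N) (cofactor N)
    (filter⁺ (p ∣?_) unique) (filter⁺ (¬? ∘ (p ∣?_)) unique)
    (swap-into (p ∣?_) (¬? ∘ (p ∣?_)) cofactor-loses-p)
    (swap-into (¬? ∘ (p ∣?_)) (p ∣?_) cofactor-gains-p)
    (λ d∈ → involutive (proj₁ (∈-filter⁻ (p ∣?_) {xs = unitaryDivisors N} d∈)))
    (λ d∈ → involutive (proj₁ (∈-filter⁻ (¬? ∘ (p ∣?_)) {xs = unitaryDivisors N} d∈)))
    where open Involution (unitary-involution N)

  withoutP⇒unitary-r : d ∈ withoutP → d ∈ unitaryDivisors r
  withoutP⇒unitary-r {d} d∈ with ∈-filter⁻ (¬? ∘ (p ∣?_)) {xs = unitaryDivisors N} d∈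
  ... | d∈ud , p∤d with ∈-unitary⁻ {n = N} d∈ud
  ...   | d∈N , coprime with coprime-divisor (coprime-^ʳ {k = suc a} (prime∤⇒coprime p-prime p∤d))
                                (divides (cofactor N d) (trans (sym (cofactor-spec d∈N)) (*-comm d _)))
  ...     | divides e r≡e*d = ∈-unitary⁺ r>0 (trans (*-comm d e) (sym r≡e*d)) (coprime-∣ʳ coprime (divides A c≡A*e))
    where
    rearrange : ∀ A e d → A * (e * d) ≡ d * (A * e)
    rearrange = solve-∀
    c≡A*e : cofactor N d ≡ A * e
    c≡A*e = *-cancelˡ-≡ _ _ d {{>-nonZero (proj₁ (∈-divisors⁻ {n = N} d∈N))}}
      (trans (cofactor-spec d∈N) (trans (cong (A *_) r≡e*d) (rearrange A e d)))

  unitary-r⇒withoutP : e ∈ unitaryDivisors r → e ∈ withoutP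
  unitary-r⇒withoutP {e} e∈ with ∈-unitary⁻ {n = r} e∈
  ... | e∈r , coprime = ∈-filter⁺ (¬? ∘ (p ∣?_))
        (∈-unitary⁺ N>0 (trans (rearrange e A _) (cong (A *_) (cofactor-spec e∈r)))
          (coprime-*ʳ (coprime-^ʳ {k = suc a} (prime∤⇒coprime p-prime p∤e)) coprime))
        p∤e
    where
    rearrange : ∀ e A c → e * (A * c) ≡ A * (e * c)
    rearrange = solve-∀
    p∤e : ¬ p ∣ e
    p∤e p∣e = p∤r (∣-trans p∣e (proj₂ (proj₂ (∈-divisors⁻ {n = r} e∈r))))

  d*-split : d* N ≡ 2 * d* r
  d*-split = begin
    d* N                                ≡⟨ sym (length-filter-split (p ∣?_) (unitaryDivisors N)) ⟩
    length withP + length withoutP      ≡⟨ cong (_+ length withoutP) length-withP≡withoutP ⟩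
    length withoutP + length withoutP   ≡⟨ cong (λ l → l + l) length-withoutP ⟩
    d* r + d* r                         ≡⟨ cong (d* r +_) (sym (+-identityʳ (d* r))) ⟩
    2 * d* r                            ∎
    where
    open ≡-Reasoning
    length-withoutP : length withoutP ≡ d* r
    length-withoutP = sameMembers⇒length-≡ (filter⁺ (¬? ∘ (p ∣?_)) (Involution.unique (unitary-involution N)))
      (Involution.unique (unitary-involution r)) withoutP⇒unitary-r unitary-r⇒withoutP

  -- Since p^(1+a) > 1, the remaining factor r is smaller than N.
  r<N : r < N
  r<N = subst (r <_) (*-comm r A) (m<m*n r A {{>-nonZero r>0}} (≤-trans (prime>1 p-prime) p≤A))
    where
    p≤A : p ≤ A
    p≤A = subst (_≤ A) (*-identityʳ p)
      (*-monoʳ-≤ p (m^n>0 p {{>-nonZero (<-trans (s≤s z≤n) (prime>1 p-prime))}} a))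

-- One step of the induction below: writing n > 1 as p^(1+a)·r with p prime,
-- p ∤ r, gives a smaller r with d*(n) = 2·d*(r).
d*-reduction : 1 < n → ∃[ r ] 0 < r × r < n × d* n ≡ 2 * d* r
d*-reduction {n} n>1 with primeDivisor n>1
... | p , p-prime , p∣n with primePowerPart p-prime n n>0
  where
  n>0 : 0 < n
  n>0 = <-trans (s≤s z≤n) n>1
...   | zero , r , n≡r , p∤r = contradiction (subst (p ∣_) (trans n≡r (*-identityˡ r)) p∣n) p∤r
...   | suc a , r , n≡pᵃr , p∤r = r , r>0 , subst (r <_) (sym n≡pᵃr) r<N ,
          trans (cong d* n≡pᵃr) d*-split
  where
  r>0 : 0 < r
  r>0 = factor-pos {c = p ^ suc a} (<-trans (s≤s z≤n) n>1) (trans (*-comm r _) (sym n≡pᵃr))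
  open UnitarySplit {a = a} p-prime p∤r r>0

d*-powerOfTwo : ∀ n → 0 < n → ∃[ k ] d* n ≡ 2 ^ k
d*-powerOfTwo = <-rec _ step
  where
  step : ∀ n → (∀ {m} → m < n → 0 < m → ∃[ k ] d* m ≡ 2 ^ k) → 0 < n → ∃[ k ] d* n ≡ 2 ^ k
  step (suc zero)        _  _ = 0 , refl
  step (suc (suc n))     ih _ with d*-reduction {suc (suc n)} (s≤s (s≤s z≤n))
  ... | r , r>0 , r<n , d*≡2d*r with ih r<n r>0
  ...   | k , d*r≡2ᵏ = suc k , trans d*≡2d*r (cong (2 *_) d*r≡2ᵏ)

odd∣*2^⇒∣ : ¬ 2 ∣ s → s ∣ x * 2 ^ k → s ∣ x
odd∣*2^⇒∣ {s} {x} {k} s-odd s∣x2ᵏ = coprime-divisor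
  (coprime-^ʳ {k = k} (prime∤⇒coprime prime[2] s-odd)) (subst (s ∣_) (*-comm x (2 ^ k)) s∣x2ᵏ)

-- A square n = m² > 1 has σ(n) odd and d*(n) a power of 2, so σ(n) ∣ n·d*(n)
-- would force σ(n) ∣ n, contradicting σ(n) > n.
σ∣n*d*⇒nonSquare : 1 < n → σ n ∣ n * d* n → ¬ (∃[ m ] (m * m ≡ n))
σ∣n*d*⇒nonSquare {n} n>1 σ∣nd* (m , refl) = <⇒≱ (n<σ n>1) (∣⇒≤ {{>-nonZero n>0}} σ∣n)
  where
  n>0 : 0 < n
  n>0 = <-trans (s≤s z≤n) n>1
  σ∣n : σ n ∣ n
  σ∣n with d*-powerOfTwo n n>0
  ... | k , d*≡2ᵏ = odd∣*2^⇒∣ {k = k} (σ-square-odd {m = m} (factor-pos {c = m} n>0 refl))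
                      (subst (λ l → σ n ∣ n * l) d*≡2ᵏ σ∣nd*)

theorem7 : ((n : ℕ) → 0 < n → σ n ≡ 2 * n →
                 (σ n ∣ n * d* n) × (σ n ∣ n * d** n))
             × ((n : ℕ) → 1 < n → σ n ∣ n * d* n → ¬ (∃[ m ] (m * m ≡ n)))
theorem7 = perfect , λ n → σ∣n*d*⇒nonSquare {n}
  where
  perfect : (n : ℕ) → 0 < n → σ n ≡ 2 * n → (σ n ∣ n * d* n) × (σ n ∣ n * d** n)
  perfect n n>0 σ≡2n = perfect⇒σ∣n*even {n = n} σ≡2n (d*-even {n} n>1)
                     , perfect⇒σ∣n*even {n = n} σ≡2n (d**-even {n} n>1)
    where
    n>1 : 1 < n
    n>1 = perfect⇒1<n n>0 σ≡2n
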